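{- Work in intuitionistic, predicative mathematics with countable choice ($AC_\omega$) but without the law of excluded middle. Let $(S,\lhd)$ be a formal cover such that for every $a\in S$ and $U\subseteq S$, if $a\lhd U$ then $a\lhd W$ for some countable subset $W\subseteq U$. Then the frame corresponding to $(S,\lhd)$ is $\sigma$-coherent.
   Context: A set $W$ is countable if there is $\alpha:\mathbb{N}\to W+\{*\}$ with $W\subseteq\alpha[\mathbb{N}]$. A basic cover on a set $S$ is a relation $\lhd$ between elements and subsets of $S$ such that (i) $a\lhd U$ whenever $a\in U$, and (ii) if $a\lhd U$ and $u\lhd V$ for all $u\in U$, then $a\lhd V$. A formal cover is a basic cover $(S,\lhd)$ together with a meet-semilattice structure $(S,\wedge,\top)$ such that $a\lhd\{\top\}$ for all $a$, and if $a\lhd U$ then $a\wedge b\lhd\{u\wedge b\mid u\in U\}$. The frame corresponding to a formal cover is $\mathcal{P}(S)/=_\lhd$ where $U=_\lhd V$ means $\forall a.(a\lhd U\Leftrightarrow a\lhd V)$, ordered by $[U]\leq[V]$ iff $u\lhd V$ for all $u\in U$, with joins $[\bigcup_i U_i]$ and binary meets $[\{u\wedge v\mid u\in U,v\in V\}]$. An element $a$ of a frame $P$ is Lindel\"of if whenever $a\leq\bigvee X$ there is a countable $W\subseteq X$ with $a\leq\bigvee W$. A frame is $\sigma$-coherent if its Lindel\"of elements are closed under finite meets and every element is a join of Lindel\"of elements. -}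

module Defs where

open import Level using (Level; _⊔_; suc; Lift)
open import Data.Nat using (ℕ)
open import Data.Maybe using (Maybe; just)
open import Data.Product using (Σ; ∃; _×_; _,_)
open import Data.Unit using (⊤)
open import Relation.Binary.PropositionalEquality using (_≡_)
open import Relation.Unary using (Pred; _∈_; _⊆_)
open import Algebra.Structures using (IsIdempotentCommutativeMonoid)

-- A subset W of a set A is countable if there is α : ℕ → W + {*}
-- (modelled as ℕ → Maybe A, with every `just` value lying in W)
-- such that W ⊆ α[ℕ].
Countable : ∀ {a ℓ} {A : Set a} → Pred A ℓ → Set (a ⊔ ℓ)
Countable {A = A} W =
  Σ (ℕ → Maybe A) λ α →
    (∀ n x → α n ≡ just x → x ∈ W) × (∀ x → x ∈ W → ∃ λ n → α n ≡ just x)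

record FormalCover (ℓ r : Level) : Set (suc (ℓ ⊔ r)) where
  infix 4 _◁_
  infixr 7 _∧_
  field
    S    : Set ℓ
    _◁_  : S → Pred S ℓ → Set r
    ◁-refl  : ∀ {a U} → a ∈ U → a ◁ U
    ◁-trans : ∀ {a U V} → a ◁ U → (∀ u → u ∈ U → u ◁ V) → a ◁ V
    _∧_  : S → S → S
    top  : S
    isMeetSemilattice : IsIdempotentCommutativeMonoid _≡_ _∧_ top
    ◁-top : ∀ a → a ◁ (λ s → s ≡ top)
    ◁-∧   : ∀ {a U} b → a ◁ U → (a ∧ b) ◁ (λ s → ∃ λ u → u ∈ U × s ≡ u ∧ b)

module Frame {ℓ r : Level} (C : FormalCover ℓ r) where
  open FormalCover C

  -- Elements of the frame P(S)/=◁ are represented by subsets of S.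
  Elem : Set (suc ℓ)
  Elem = Pred S ℓ

  _≈_ : Elem → Elem → Set (ℓ ⊔ r)
  U ≈ V = ∀ a → (a ◁ U → a ◁ V) × (a ◁ V → a ◁ U)

  _≤_ : Elem → Elem → Set (ℓ ⊔ r)
  U ≤ V = ∀ u → u ∈ U → u ◁ V

  ⊤ᶠ : Elem
  ⊤ᶠ = λ _ → Lift ℓ ⊤

  _⊓_ : Elem → Elem → Elem
  U ⊓ V = λ s → ∃ λ u → ∃ λ v → u ∈ U × v ∈ V × s ≡ u ∧ v

  ⋁ : {I : Set ℓ} → (I → Elem) → Elem
  ⋁ {I} X = λ s → ∃ λ (i : I) → s ∈ X i

  ⋁[_] : {I : Set ℓ} → Pred I ℓ → (I → Elem) → Elem
  ⋁[_] {I} W X = λ s → ∃ λ (i : I) → i ∈ W × s ∈ X i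

  -- Lindelöf element: whenever A ≤ ⋁X there is a countable W ⊆ X with A ≤ ⋁W.
  -- (Subsets X of the frame are given as set-indexed families; countable
  -- subsets of X as countable subsets of the index set.)
  Lindelof : Elem → Set (suc ℓ ⊔ r)
  Lindelof A = ∀ (I : Set ℓ) (X : I → Elem) → A ≤ ⋁ X →
    Σ (Pred I ℓ) λ W → Countable W × A ≤ ⋁[ W ] X

  σ-Coherent : Set (suc ℓ ⊔ r)
  σ-Coherent =
    Lindelof ⊤ᶠ
    × (∀ A B → Lindelof A → Lindelof B → Lindelof (A ⊓ B))
    × (∀ (U : Elem) → Σ (Set ℓ) λ I → Σ (I → Elem) λ X →
         (∀ i → Lindelof (X i)) × (U ≈ ⋁ X))

CountablyCovered : ∀ {ℓ r} → FormalCover ℓ r → Set (suc ℓ ⊔ r)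
CountablyCovered {ℓ} C = ∀ a (U : Pred S ℓ) → a ◁ U →
    Σ (Pred S ℓ) λ W → Countable W × W ⊆ U × a ◁ W
  where open FormalCover C

module Submission where

open import Level using (Level; lift)
open import Data.Unit using (tt)
open import Function using (_∘_)
open import Data.Nat using (ℕ; zero; suc; _+_)
open import Data.Nat.Properties using (+-suc; +-identityʳ)
open import Data.Maybe using (Maybe; just; nothing; map; zipWith)
open import Data.Maybe.Properties using (just-injective; map-just)
open import Data.Product using (Σ; ∃; ∃₂; _×_; _,_; proj₁; proj₂; uncurry)
open import Relation.Binary.PropositionalEquality using (_≡_; refl; sym; trans; cong; cong₂; subst)
open import Relation.Unary using (Pred; _∈_; _⊆_)
open import Algebra.Structures using (IsIdempotentCommutativeMonoid)
open import Defs

-- A Lindelöf subset is always equivalent to the range of an enumeration ℕ → Maybe S, and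
-- under the hypothesis every such range is Lindelöf: choose a countable subcover for each
-- enumerated element (countable choice) and enumerate all of them together along ℕ × ℕ.
-- The meet of two ranges is the range of their pairwise meets, and every subset is the
-- join of the singletons of its elements.

next : ℕ × ℕ → ℕ × ℕ
next (zero  , m) = suc m , zero
next (suc n , m) = n , suc m

unpair : ℕ → ℕ × ℕ
unpair zero    = zero , zero
unpair (suc k) = next (unpair k)

unpair-walk : ∀ j {k n m} → unpair k ≡ (j + n , m) → unpair (j + k) ≡ (n , j + m)
unpair-walk zero    e = e
unpair-walk (suc j) {n = n} {m} e =
  cong next (unpair-walk j (trans e (cong (_, m) (sym (+-suc j n)))))

unpair-diagonal : ∀ d → ∃ λ k → unpair k ≡ (d , zero)
unpair-diagonal zero = zero , refl
unpair-diagonal (suc d) with unpair-diagonal d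
... | k , e = suc (d + k) ,
  cong next (subst (λ j → unpair (d + k) ≡ (zero , j)) (+-identityʳ d)
                   (unpair-walk d (trans e (cong (_, zero) (sym (+-identityʳ d))))))

unpair-surjective : ∀ n m → ∃ λ k → unpair k ≡ (n , m)
unpair-surjective n m with unpair-diagonal (m + n)
... | k , e = m + k ,
  subst (λ j → unpair (m + k) ≡ (n , j)) (+-identityʳ m) (unpair-walk m e)

Enumeration : ∀ {a} → Set a → Set a
Enumeration A = ℕ → Maybe A

module _ {a} {A : Set a} where

  range : Enumeration A → Pred A a
  range α x = ∃ λ n → α n ≡ just x

  range-countable : (α : Enumeration A) → Countable (range α)
  range-countable α = α , (λ n _ e → n , e) , (λ _ p → p)

  ⋃ : (ℕ → Enumeration A) → Enumeration A
  ⋃ α = uncurry α ∘ unpair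

  ∈-range-⋃ : ∀ {α : ℕ → Enumeration A} {x} n m → α n m ≡ just x → x ∈ range (⋃ α)
  ∈-range-⋃ {α} n m e with unpair-surjective n m
  ... | k , p = k , trans (cong (uncurry α) p) e

  attach : ∀ {p} {P : Pred A p} (x : Maybe A) → (∀ y → x ≡ just y → P y) → Maybe (Σ A P)
  attach nothing  _   = nothing
  attach (just y) P-y = just (y , P-y y refl)

  attach-just : ∀ {p} {P : Pred A p} {x : Maybe A} (P-x : ∀ y → x ≡ just y → P y)
                {y} (e : x ≡ just y) → attach x P-x ≡ just (y , P-x y e)
  attach-just _ refl = refl

module _ {a} {A : Set a} where

  enumerateMembers : ∀ {ℓ} {W : Pred A ℓ} → Countable W →
    Σ (Enumeration (Σ A (_∈ W))) λ β → ∀ x → x ∈ W → ∃ λ p → (x , p) ∈ range β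
  enumerateMembers {W = W} (α , α-in , α-onto) = β , members
    where
    β : Enumeration (Σ A (_∈ W))
    β n = attach (α n) (α-in n)
    members : ∀ x → x ∈ W → ∃ λ p → (x , p) ∈ range β
    members x x∈W with α-onto x x∈W
    ... | n , e = α-in n x e , n , attach-just (α-in n) e

module _ {a b} {A : Set a} {B : Set b} where

  ∈-range-map : ∀ {f : A → B} {α x} → x ∈ range α → f x ∈ range (map f ∘ α)
  ∈-range-map (n , e) = n , map-just e

  map-just⁻¹ : ∀ {f : A → B} (x : Maybe A) {y} → map f x ≡ just y →
    ∃ λ x′ → x ≡ just x′ × f x′ ≡ y
  map-just⁻¹ (just x) refl = x , refl , refl

  range-map⁻¹ : ∀ {f : A → B} {α y} → y ∈ range (map f ∘ α) → ∃ λ x → x ∈ range α × f x ≡ y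
  range-map⁻¹ {α = α} (n , e) with map-just⁻¹ (α n) e
  ... | x , e′ , fx≡y = x , (n , e′) , fx≡y

module _ {a b c} {A : Set a} {B : Set b} {C : Set c} where

  zipWith-just⁻¹ : ∀ {f : A → B → C} (x : Maybe A) (y : Maybe B) {z} → zipWith f x y ≡ just z →
    ∃₂ λ x′ y′ → x ≡ just x′ × y ≡ just y′ × f x′ y′ ≡ z
  zipWith-just⁻¹ (just x) (just y) refl = x , y , refl , refl , refl

  pairwise : (A → B → C) → Enumeration A → Enumeration B → Enumeration C
  pairwise f α β = ⋃ λ n m → zipWith f (α n) (β m)

  ∈-range-pairwise : ∀ {f α β x y} → x ∈ range α → y ∈ range β → f x y ∈ range (pairwise f α β)
  ∈-range-pairwise {f} (n , e) (m , e′) = ∈-range-⋃ n m (cong₂ (zipWith f) e e′)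

  range-pairwise⁻¹ : ∀ {f α β z} → z ∈ range (pairwise f α β) →
    ∃₂ λ x y → x ∈ range α × y ∈ range β × f x y ≡ z
  range-pairwise⁻¹ {α = α} {β} (k , e) with unpair k
  ... | n , m with zipWith-just⁻¹ (α n) (β m) e
  ... | x , y , ex , ey , fxy≡z = x , y , (n , ex) , (m , ey) , fxy≡z

module CoverProperties {ℓ r} (C : FormalCover ℓ r) where
  open FormalCover C
  open Frame C

  ∧-comm : ∀ x y → x ∧ y ≡ y ∧ x
  ∧-comm = IsIdempotentCommutativeMonoid.comm isMeetSemilattice

  ◁-resp-≡ : ∀ {s t U} → s ≡ t → s ◁ U → t ◁ U
  ◁-resp-≡ refl s◁U = s◁U

  ◁-mono : ∀ {a} {U V : Elem} → a ◁ U → U ⊆ V → a ◁ V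
  ◁-mono a◁U U⊆V = ◁-trans a◁U λ u u∈U → ◁-refl (U⊆V u∈U)

  ⊆⇒≤ : {U V : Elem} → U ⊆ V → U ≤ V
  ⊆⇒≤ U⊆V u u∈U = ◁-refl (U⊆V u∈U)

  ≤-trans : {U V W : Elem} → U ≤ V → V ≤ W → U ≤ W
  ≤-trans U≤V V≤W u u∈U = ◁-trans (U≤V u u∈U) V≤W

  ≤-antisym : {U V : Elem} → U ≤ V → V ≤ U → U ≈ V
  ≤-antisym U≤V V≤U a = (λ a◁U → ◁-trans a◁U U≤V) , (λ a◁V → ◁-trans a◁V V≤U)

  ⊓-comm : {A B : Elem} → (A ⊓ B) ⊆ (B ⊓ A)
  ⊓-comm (u , v , u∈A , v∈B , s≡u∧v) = v , u , v∈B , u∈A , trans s≡u∧v (∧-comm u v)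

  ⊓-monoˡ-≤ : {A A′ B : Elem} → A ≤ A′ → (A ⊓ B) ≤ (A′ ⊓ B)
  ⊓-monoˡ-≤ A≤A′ s (u , v , u∈A , v∈B , s≡u∧v) =
    ◁-resp-≡ (sym s≡u∧v) (◁-mono (◁-∧ v (A≤A′ u u∈A))
      λ (u′ , u′∈A′ , t≡u′∧v) → u′ , v , u′∈A′ , v∈B , t≡u′∧v)

  ⊓-mono-≤ : {A A′ B B′ : Elem} → A ≤ A′ → B ≤ B′ → (A ⊓ B) ≤ (A′ ⊓ B′)
  ⊓-mono-≤ A≤A′ B≤B′ =
    ≤-trans (⊓-monoˡ-≤ A≤A′)
      (≤-trans (⊆⇒≤ ⊓-comm) (≤-trans (⊓-monoˡ-≤ B≤B′) (⊆⇒≤ ⊓-comm)))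

  ⋁[]-mono : ∀ {I : Set ℓ} {W W′ : Pred I ℓ} (X : I → Elem) → W ⊆ W′ → ⋁[ W ] X ⊆ ⋁[ W′ ] X
  ⋁[]-mono X W⊆W′ (i , i∈W , s∈Xi) = i , W⊆W′ i∈W , s∈Xi

  ⟨_⟩ : S → Elem
  ⟨ a ⟩ s = s ≡ a

  Lindelof-resp : {A B : Elem} → A ≤ B → B ≤ A → Lindelof B → Lindelof A
  Lindelof-resp A≤B B≤A LB I X A≤⋁X with LB I X (≤-trans B≤A A≤⋁X)
  ... | W , W-countable , B≤⋁W = W , W-countable , ≤-trans A≤B B≤⋁W

  Lindelof⇒range : {A : Elem} → Lindelof A → Σ (Enumeration S) λ γ → A ≤ range γ × range γ ⊆ A
  Lindelof⇒range {A} LA with LA (Σ S (_∈ A)) (⟨_⟩ ∘ proj₁) (λ a a∈A → ◁-refl ((a , a∈A) , refl))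
  ... | W , (α , α-in , α-onto) , A≤⋁W = map proj₁ ∘ α , A≤range , range⊆A
    where
    A≤range : A ≤ range (map proj₁ ∘ α)
    A≤range a a∈A = ◁-mono (A≤⋁W a a∈A) λ where
      (i , i∈W , refl) → ∈-range-map (α-onto i i∈W)
    range⊆A : range (map proj₁ ∘ α) ⊆ A
    range⊆A s∈range with range-map⁻¹ {f = proj₁} {α = α} s∈range
    ... | (a , a∈A) , _ , refl = a∈A

  ≈-⋁-⟨⟩ : (U : Elem) → U ≈ ⋁ (⟨_⟩ ∘ proj₁ {B = _∈ U})
  ≈-⋁-⟨⟩ U = ≤-antisym (⊆⇒≤ λ u∈U → (_ , u∈U) , refl) (⊆⇒≤ λ where ((_ , u∈U) , refl) → u∈U)

module CountablyCoveredFrame {ℓ r} (C : FormalCover ℓ r) (countablyCovered : CountablyCovered C) where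
  open FormalCover C
  open Frame C
  open CoverProperties C

  countableSubcover : ∀ {a} {I : Set ℓ} (X : I → Elem) → a ◁ ⋁ X →
    Σ (Enumeration I) λ β → a ◁ ⋁[ range β ] X
  countableSubcover {a} {I} X a◁⋁X with countablyCovered a (⋁ X) a◁⋁X
  ... | W , W-countable , W⊆⋁X , a◁W with enumerateMembers W-countable
  ... | β , members = map index ∘ β , ◁-mono a◁W covered
    where
    index : Σ S (_∈ W) → I
    index (_ , w∈W) = proj₁ (W⊆⋁X w∈W)
    covered : W ⊆ ⋁[ range (map index ∘ β) ] X
    covered {w} w∈W with members w w∈W
    ... | p , w∈β = index (w , p) , ∈-range-map w∈β , proj₂ (W⊆⋁X p)

  countableSubcoverᵐ : ∀ {I : Set ℓ} (X : I → Elem) (x : Maybe S) → (∀ c → x ≡ just c → c ◁ ⋁ X) →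
    Σ (Enumeration I) λ β → ∀ c → x ≡ just c → c ◁ ⋁[ range β ] X
  countableSubcoverᵐ X nothing  _    = (λ _ → nothing) , λ _ ()
  countableSubcoverᵐ X (just c) c◁⋁X with countableSubcover X (c◁⋁X c refl)
  ... | β , c◁⋁β = β , λ where _ refl → c◁⋁β

  range-Lindelof : (γ : Enumeration S) → Lindelof (range γ)
  range-Lindelof γ I X γ≤⋁X = range β , range-countable β , covered
    where
    subcover : ∀ n → Σ (Enumeration I) λ β → ∀ c → γ n ≡ just c → c ◁ ⋁[ range β ] X
    subcover n = countableSubcoverᵐ X (γ n) (λ c e → γ≤⋁X c (n , e))
    β : Enumeration I
    β = ⋃ (proj₁ ∘ subcover)
    covered : range γ ≤ ⋁[ range β ] X
    covered c (n , e) = ◁-mono (proj₂ (subcover n) c e) (⋁[]-mono X λ (m , e′) → ∈-range-⋃ n m e′)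

  Lindelof-⟨⟩ : ∀ a → Lindelof ⟨ a ⟩
  Lindelof-⟨⟩ a = Lindelof-resp (⊆⇒≤ λ s≡a → 0 , cong just (sym s≡a))
                                (⊆⇒≤ λ (_ , e) → sym (just-injective e))
                                (range-Lindelof λ _ → just a)

  Lindelof-⊤ : Lindelof ⊤ᶠ
  Lindelof-⊤ = Lindelof-resp (λ s _ → ◁-top s) (⊆⇒≤ λ _ → lift tt) (Lindelof-⟨⟩ top)

  Lindelof-⊓ : ∀ A B → Lindelof A → Lindelof B → Lindelof (A ⊓ B)
  Lindelof-⊓ A B LA LB with Lindelof⇒range LA | Lindelof⇒range LB
  ... | γ , A≤γ , γ⊆A | δ , B≤δ , δ⊆B =
    Lindelof-resp (≤-trans (⊓-mono-≤ A≤γ B≤δ) (⊆⇒≤ ⊓⊆range)) (⊆⇒≤ range⊆⊓) (range-Lindelof ε)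
    where
    ε : Enumeration S
    ε = pairwise _∧_ γ δ
    ⊓⊆range : (range γ ⊓ range δ) ⊆ range ε
    ⊓⊆range (_ , _ , x∈γ , y∈δ , refl) = ∈-range-pairwise x∈γ y∈δ
    range⊆⊓ : range ε ⊆ (A ⊓ B)
    range⊆⊓ s∈ε with range-pairwise⁻¹ {f = _∧_} {α = γ} {β = δ} s∈ε
    ... | x , y , x∈γ , y∈δ , refl = x , y , γ⊆A x∈γ , δ⊆B y∈δ , refl

mainTheorem7 : ∀ {ℓ r : Level} (C : FormalCover ℓ r) →
    CountablyCovered C → Frame.σ-Coherent C
mainTheorem7 C countablyCovered =
  Lindelof-⊤ , Lindelof-⊓ , λ U → _ , ⟨_⟩ ∘ proj₁ , Lindelof-⟨⟩ ∘ proj₁ , ≈-⋁-⟨⟩ U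
  where
  open CoverProperties C
  open CountablyCoveredFrame C countablyCovered
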